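{- For every integer $b\geq 1$ there exists a shiftable $SMR(4b+2,3(4b+2);6,2)$.
   Context: A signed magic rectangle $SMR(m,n;r,s)$ is an $m\times n$ array, some of whose cells are filled with integers and the others empty, such that exactly $r$ cells in every row and exactly $s$ cells in every column are filled (so $mr=ns$), every element of $X$ appears exactly once in the array, and the sum of the entries of each row and of each column is zero, where (for $mr$ even) $X=\{\pm1,\pm2,\ldots,\pm mr/2\}$. An array is shiftable if every row and every column contains the same number of positive entries as negative entries. -}

module Defs where

open import Data.Nat using (ℕ; suc; _*_; _/_)
open import Data.Integer as ℤ using (ℤ; +_; -[1+_]; +[1+_]; 0ℤ)
open import Data.Fin using (Fin)
open import Data.List using (List; length; filter; map; sum; allFin; concatMap)
open import Data.Maybe using (Maybe; just; nothing)
open import Data.Product using (_×_; _,_; ∃)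
open import Relation.Nullary using (Dec; yes; no)
open import Relation.Unary using (Pred; Decidable)
open import Relation.Binary.PropositionalEquality using (_≡_)
open import Level using (0ℓ)

-- A partially filled m × n array of integers (nothing = empty cell).
Array : ℕ → ℕ → Set
Array m n = Fin m → Fin n → Maybe ℤ

IsFilled : Maybe ℤ → Set
IsFilled (just _) = Data.Unit.⊤ where import Data.Unit
IsFilled nothing  = Data.Empty.⊥ where import Data.Empty

isFilled? : Decidable IsFilled
isFilled? (just _) = yes _
isFilled? nothing  = no (λ ())

IsPos : Maybe ℤ → Set
IsPos (just +[1+ _ ]) = Data.Unit.⊤ where import Data.Unit
IsPos _ = Data.Empty.⊥ where import Data.Empty

isPos? : Decidable IsPos
isPos? (just +[1+ _ ]) = yes _
isPos? (just (+ 0)) = no (λ ())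
isPos? (just -[1+ _ ]) = no (λ ())
isPos? nothing = no (λ ())

IsNeg : Maybe ℤ → Set
IsNeg (just -[1+ _ ]) = Data.Unit.⊤ where import Data.Unit
IsNeg _ = Data.Empty.⊥ where import Data.Empty

isNeg? : Decidable IsNeg
isNeg? (just -[1+ _ ]) = yes _
isNeg? (just (+ _)) = no (λ ())
isNeg? nothing = no (λ ())

val : Maybe ℤ → ℤ
val (just x) = x
val nothing  = 0ℤ

row : ∀ {m n} → Array m n → Fin m → List (Maybe ℤ)
row {n = n} A i = map (A i) (allFin n)

col : ∀ {m n} → Array m n → Fin n → List (Maybe ℤ)
col {m = m} A j = map (λ i → A i j) (allFin m)

cells : ∀ {m n} → Array m n → List (Maybe ℤ)
cells {m = m} A = concatMap (row A) (allFin m)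

zsum : List (Maybe ℤ) → ℤ
zsum xs = Data.List.foldr ℤ._+_ 0ℤ (map val xs)

#filled #pos #neg : List (Maybe ℤ) → ℕ
#filled xs = length (filter isFilled? xs)
#pos xs = length (filter isPos? xs)
#neg xs = length (filter isNeg? xs)

#occ : ∀ {m n} → Array m n → ℤ → ℕ
#occ A x = length (filter (λ c → Data.Maybe.Properties.≡-dec ℤ._≟_ c (just x)) (cells A))
  where import Data.Maybe.Properties

InX : ℕ → ℤ → Set
InX k x = (1 Data.Nat.≤ ℤ.∣ x ∣) × (ℤ.∣ x ∣ Data.Nat.≤ k)

-- Signed magic rectangle SMR(m,n;r,s) with the even case X = {±1,…,±mr/2}
record IsSMR (m n r s : ℕ) (A : Array m n) : Set where
  field
    rowCount  : ∀ i → #filled (row A i) ≡ r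
    colCount  : ∀ j → #filled (col A j) ≡ s
    entriesInX : ∀ i j x → A i j ≡ just x → InX ((m * r) / 2) x
    eachOnce  : ∀ x → InX ((m * r) / 2) x → #occ A x ≡ 1
    rowSum    : ∀ i → zsum (row A i) ≡ 0ℤ
    colSum    : ∀ j → zsum (col A j) ≡ 0ℤ

record IsShiftable {m n : ℕ} (A : Array m n) : Set where
  field
    rowBal : ∀ i → #pos (row A i) ≡ #neg (row A i)
    colBal : ∀ j → #pos (col A j) ≡ #neg (col A j)

module Submission where

-- Put a shiftable SMR(m,n;r,s) A and a shiftable SMR(m′,n′;r,s) B on the diagonal and move
-- every entry of B away from zero by K = mr/2.  Because each line of B has as many positive
-- as negative entries, the shift leaves its sum at zero, and it carries X_{m′r/2} onto
-- X_{K + m′r/2} ∖ X_K, so the sum is a shiftable SMR(m+m′,n+n′;r,s).  Starting from explicit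
-- shiftable SMR(6,18;6,2) and SMR(4,12;6,2), adding four rows at a time reaches every 4b+2.

open import Defs
open import Data.Bool using (if_then_else_)
open import Data.Empty using (⊥-elim)
open import Data.Fin using (Fin; zero; suc; toℕ; fromℕ<; splitAt; join; _↑ˡ_; _↑ʳ_)
open import Data.Fin.Properties using (all?; splitAt-join; join-splitAt; toℕ<n; toℕ-fromℕ<)
open import Data.Integer as ℤ using (ℤ; +_; -[1+_]; +[1+_]; 0ℤ; ∣_∣)
import Data.Integer.Properties as ℤ
open import Data.Integer.Tactic.RingSolver using (solve-∀)
open import Data.List using (List; []; _∷_; _++_; map; concat; tabulate; replicate; allFin; length; filter)
open import Data.List.Properties using (filter-++; length-++; filter-none; map-tabulate; map-cong; map-∘; concat-map)
open import Data.List.Relation.Unary.All using (All; universal)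
open import Data.List.Relation.Unary.All.Properties using (replicate⁺; map⁺; tabulate⁺; concat⁺)
open import Data.Maybe using (Maybe; just; nothing)
open import Data.Maybe.Properties using (just-injective; ≡-dec)
import Data.Maybe as Maybe
open import Data.Nat as ℕ using (ℕ; _+_; _*_; _/_; _∸_; _≤_; _≤?_; _≟_; _≡ᵇ_; s≤s; z≤n)
open import Data.Nat.Divisibility using (_∣_; divides; ∣n⇒∣m*n)
open import Data.Nat.DivMod using (+-distrib-/-∣ˡ)
open import Data.Nat.ListAction using (sum)
open import Data.Nat.ListAction.Properties using (sum-++)
import Data.Nat.Properties as ℕ
open import Data.Product using (Σ; ∃₂; _×_; _,_; proj₁; proj₂)
open import Data.Sum using (_⊎_; inj₁; inj₂)
open import Data.Vec using (Vec; lookup) renaming (_∷_ to _∷ᵥ_; [] to []ᵥ)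
open import Function using (_∘_; id)
open import Level using (0ℓ)
open import Relation.Binary.PropositionalEquality
open import Relation.Nullary using (Dec; yes; no; ¬_)
open import Relation.Nullary.Decidable using (map′; _×-dec_; from-yes)
open import Relation.Unary using (Pred; Decidable; ∁)

open ≡-Reasoning

private
  variable
    T : Set
    m n m′ n′ r r′ s K K′ : ℕ

tabulate-+ : ∀ m {n} (f : Fin (m + n) → T) →
             tabulate f ≡ tabulate (f ∘ (_↑ˡ n)) ++ tabulate (f ∘ (m ↑ʳ_))
tabulate-+ ℕ.zero    f = refl
tabulate-+ (ℕ.suc m) f = cong (f zero ∷_) (tabulate-+ m (f ∘ suc))

map-allFin-+ : ∀ m {n} (f : Fin (m + n) → T) →
               map f (allFin (m + n)) ≡ map (f ∘ (_↑ˡ n)) (allFin m) ++ map (f ∘ (m ↑ʳ_)) (allFin n)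
map-allFin-+ m {n} f = begin
  map f (allFin (m + n))                                        ≡⟨ map-tabulate id f ⟩
  tabulate f                                                    ≡⟨ tabulate-+ m f ⟩
  tabulate (f ∘ (_↑ˡ n)) ++ tabulate (f ∘ (m ↑ʳ_))              ≡⟨ sym (cong₂ _++_ (map-tabulate id (f ∘ (_↑ˡ n)))
                                                                                  (map-tabulate id (f ∘ (m ↑ʳ_)))) ⟩
  map (f ∘ (_↑ˡ n)) (allFin m) ++ map (f ∘ (m ↑ʳ_)) (allFin n)  ∎

map-allFin-const : ∀ n (x : T) → map (λ _ → x) (allFin n) ≡ replicate n x
map-allFin-const n x = trans (map-tabulate id (λ _ → x)) (tabulate-const n)
  where
  tabulate-const : ∀ n → tabulate {n = n} (λ _ → x) ≡ replicate n x
  tabulate-const ℕ.zero    = refl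
  tabulate-const (ℕ.suc n) = cong (x ∷_) (tabulate-const n)

count : {P : Pred (Maybe ℤ) 0ℓ} → Decidable P → List (Maybe ℤ) → ℕ
count P? xs = length (filter P? xs)

blank : ℕ → List (Maybe ℤ)
blank n = replicate n nothing

module _ {P : Pred (Maybe ℤ) 0ℓ} (P? : Decidable P) where

  count-++ : ∀ xs ys → count P? (xs ++ ys) ≡ count P? xs + count P? ys
  count-++ xs ys = trans (cong length (filter-++ P? xs ys)) (length-++ (filter P? xs))

  count-none : ∀ {xs} → All (∁ P) xs → count P? xs ≡ 0
  count-none ¬Ps = cong length (filter-none P? ¬Ps)

  count-blank : ¬ P nothing → ∀ n → count P? (blank n) ≡ 0
  count-blank ¬P∅ n = count-none (replicate⁺ n ¬P∅)

  count-concat : ∀ xss → count P? (concat xss) ≡ sum (map (count P?) xss)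
  count-concat []         = refl
  count-concat (xs ∷ xss) = trans (count-++ xs (concat xss)) (cong (_+_ (count P? xs)) (count-concat xss))

  count-map : {Q : Pred (Maybe ℤ) 0ℓ} (Q? : Decidable Q) (f : Maybe ℤ → Maybe ℤ) →
              (∀ c → P (f c) → Q c) → (∀ c → Q c → P (f c)) →
              ∀ xs → count P? (map f xs) ≡ count Q? xs
  count-map Q? f to from []       = refl
  count-map Q? f to from (x ∷ xs) with P? (f x) | Q? x
  ... | yes _   | yes _   = cong ℕ.suc (count-map Q? f to from xs)
  ... | no _    | no _    = count-map Q? f to from xs
  ... | yes Pfx | no ¬Qx  = ⊥-elim (¬Qx (to x Pfx))
  ... | no ¬Pfx | yes Qx  = ⊥-elim (¬Pfx (from x Qx))

zsum-++ : ∀ xs ys → zsum (xs ++ ys) ≡ zsum xs ℤ.+ zsum ys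
zsum-++ []       ys = sym (ℤ.+-identityˡ (zsum ys))
zsum-++ (x ∷ xs) ys = trans (cong (ℤ._+_ (val x)) (zsum-++ xs ys)) (sym (ℤ.+-assoc (val x) (zsum xs) (zsum ys)))

zsum-blank : ∀ n → zsum (blank n) ≡ 0ℤ
zsum-blank ℕ.zero    = refl
zsum-blank (ℕ.suc n) = trans (ℤ.+-identityˡ (zsum (blank n))) (zsum-blank n)

shift : ℕ → ℤ → ℤ
shift K (+ ℕ.zero) = + ℕ.zero
shift K +[1+ n ]   = +[1+ n + K ]
shift K -[1+ n ]   = -[1+ n + K ]

shiftCell : ℕ → Maybe ℤ → Maybe ℤ
shiftCell K = Maybe.map (shift K)

zsum-shift : ∀ K xs → zsum (map (shiftCell K) xs) ≡ zsum xs ℤ.+ + K ℤ.* (+ #pos xs ℤ.- + #neg xs)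
zsum-shift K []                   = neutral (+ K)
  where
  neutral : ∀ k → 0ℤ ≡ 0ℤ ℤ.+ k ℤ.* (0ℤ ℤ.- 0ℤ)
  neutral = solve-∀
zsum-shift K (nothing ∷ xs)       = trans (cong (ℤ._+_ 0ℤ) (zsum-shift K xs)) (sym (ℤ.+-assoc 0ℤ (zsum xs) (+ K ℤ.* (+ #pos xs ℤ.- + #neg xs))))
zsum-shift K (just (+ 0) ∷ xs)    = trans (cong (ℤ._+_ 0ℤ) (zsum-shift K xs)) (sym (ℤ.+-assoc 0ℤ (zsum xs) (+ K ℤ.* (+ #pos xs ℤ.- + #neg xs))))
zsum-shift K (just +[1+ n ] ∷ xs) =
  trans (cong (ℤ._+_ (+[1+ n + K ])) (zsum-shift K xs)) (step +[1+ n ] (zsum xs) (+ K) (+ #pos xs) (+ #neg xs))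
  where
  step : ∀ a z k p q → (a ℤ.+ k) ℤ.+ (z ℤ.+ k ℤ.* (p ℤ.- q)) ≡ (a ℤ.+ z) ℤ.+ k ℤ.* ((ℤ.1ℤ ℤ.+ p) ℤ.- q)
  step = solve-∀
zsum-shift K (just -[1+ n ] ∷ xs) =
  trans (cong₂ ℤ._+_ (ℤ.neg-distrib-+ +[1+ n ] (+ K)) (zsum-shift K xs))
        (step -[1+ n ] (zsum xs) (+ K) (+ #pos xs) (+ #neg xs))
  where
  step : ∀ a z k p q → (a ℤ.- k) ℤ.+ (z ℤ.+ k ℤ.* (p ℤ.- q)) ≡ (a ℤ.+ z) ℤ.+ k ℤ.* (p ℤ.- (ℤ.1ℤ ℤ.+ q))
  step = solve-∀

zsum-shift-balanced : ∀ K xs → #pos xs ≡ #neg xs → zsum (map (shiftCell K) xs) ≡ zsum xs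
zsum-shift-balanced K xs balanced = begin
  zsum (map (shiftCell K) xs)                       ≡⟨ zsum-shift K xs ⟩
  zsum xs ℤ.+ + K ℤ.* (+ #pos xs ℤ.- + #neg xs)     ≡⟨ cong (λ p → zsum xs ℤ.+ + K ℤ.* (+ p ℤ.- + #neg xs)) balanced ⟩
  zsum xs ℤ.+ + K ℤ.* (+ #neg xs ℤ.- + #neg xs)     ≡⟨ cancel (zsum xs) (+ K) (+ #neg xs) ⟩
  zsum xs                                           ∎
  where
  cancel : ∀ z k q → z ℤ.+ k ℤ.* (q ℤ.- q) ≡ z
  cancel = solve-∀

-- Lines of a shiftable signed magic rectangle

record MagicLine (r : ℕ) (xs : List (Maybe ℤ)) : Set where
  field
    filled   : #filled xs ≡ r
    sumZero  : zsum xs ≡ 0ℤ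
    balanced : #pos xs ≡ #neg xs

open MagicLine

magic-++ : ∀ {xs ys} → MagicLine r xs → MagicLine r′ ys → MagicLine (r + r′) (xs ++ ys)
magic-++ {xs = xs} {ys} L M = record
  { filled   = trans (count-++ isFilled? xs ys) (cong₂ _+_ (filled L) (filled M))
  ; sumZero  = trans (zsum-++ xs ys) (cong₂ ℤ._+_ (sumZero L) (sumZero M))
  ; balanced = trans (count-++ isPos? xs ys)
                 (trans (cong₂ _+_ (balanced L) (balanced M)) (sym (count-++ isNeg? xs ys)))
  }

magic-blank : ∀ n → MagicLine 0 (blank n)
magic-blank n = record
  { filled   = count-blank isFilled? (λ ()) n
  ; sumZero  = zsum-blank n
  ; balanced = trans (count-blank isPos? (λ ()) n) (sym (count-blank isNeg? (λ ()) n))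
  }

magic-shift : ∀ K {xs} → MagicLine r xs → MagicLine r (map (shiftCell K) xs)
magic-shift K {xs} L = record
  { filled   = trans (count-map isFilled? isFilled? (shiftCell K) filledTo filledFrom xs) (filled L)
  ; sumZero  = trans (zsum-shift-balanced K xs (balanced L)) (sumZero L)
  ; balanced = begin
      #pos (map (shiftCell K) xs) ≡⟨ count-map isPos? isPos? (shiftCell K) posTo posFrom xs ⟩
      #pos xs                     ≡⟨ balanced L ⟩
      #neg xs                     ≡⟨ sym (count-map isNeg? isNeg? (shiftCell K) negTo negFrom xs) ⟩
      #neg (map (shiftCell K) xs) ∎
  }
  where
  filledTo : ∀ c → IsFilled (shiftCell K c) → IsFilled c
  filledTo (just _) _ = _
  filledFrom : ∀ c → IsFilled c → IsFilled (shiftCell K c)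
  filledFrom (just _) _ = _
  posTo : ∀ c → IsPos (shiftCell K c) → IsPos c
  posTo (just +[1+ _ ]) _ = _
  posTo (just (+ 0)) ()
  posTo (just -[1+ _ ]) ()
  posFrom : ∀ c → IsPos c → IsPos (shiftCell K c)
  posFrom (just +[1+ _ ]) _ = _
  negTo : ∀ c → IsNeg (shiftCell K c) → IsNeg c
  negTo (just -[1+ _ ]) _ = _
  negTo (just (+ 0)) ()
  negTo (just +[1+ _ ]) ()
  negFrom : ∀ c → IsNeg c → IsNeg (shiftCell K c)
  negFrom (just -[1+ _ ]) _ = _

InX-weaken : ∀ K′ x → InX K x → InX (K + K′) x
InX-weaken {K} K′ x (1≤∣x∣ , ∣x∣≤K) = 1≤∣x∣ , ℕ.≤-trans ∣x∣≤K (ℕ.m≤m+n K K′)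

InX-shift : ∀ K {K′} y → InX K′ y → InX (K + K′) (shift K y)
InX-shift K {K′} +[1+ n ] (_ , 1+n≤K′) = s≤s z≤n , subst (_≤ K + K′) (ℕ.+-comm K (ℕ.suc n)) (ℕ.+-monoʳ-≤ K 1+n≤K′)
InX-shift K {K′} -[1+ n ] (_ , 1+n≤K′) = s≤s z≤n , subst (_≤ K + K′) (ℕ.+-comm K (ℕ.suc n)) (ℕ.+-monoʳ-≤ K 1+n≤K′)

shift-∉ : ∀ K y x → InX K x → shift K y ≢ x
shift-∉ K (+ 0)    _ (() , _) refl
shift-∉ K +[1+ n ] _ (_ , ∣x∣≤K) refl = ℕ.<⇒≱ (s≤s (ℕ.m≤n+m K n)) ∣x∣≤K
shift-∉ K -[1+ n ] _ (_ , ∣x∣≤K) refl = ℕ.<⇒≱ (s≤s (ℕ.m≤n+m K n)) ∣x∣≤K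

shift-injective : ∀ K x y → shift K x ≡ shift K y → x ≡ y
shift-injective K (+ 0)    (+ 0)    _ = refl
shift-injective K +[1+ n ] +[1+ _ ] e = cong +[1+_] (ℕ.+-cancelʳ-≡ K n _ (ℕ.suc-injective (ℤ.+-injective e)))
shift-injective K -[1+ n ] -[1+ _ ] e = cong -[1+_] (ℕ.+-cancelʳ-≡ K n _ (ℤ.-[1+-injective e))
shift-injective K (+ 0)    +[1+ _ ] ()
shift-injective K (+ 0)    -[1+ _ ] ()
shift-injective K +[1+ _ ] (+ 0)    ()
shift-injective K +[1+ _ ] -[1+ _ ] ()
shift-injective K -[1+ _ ] (+ 0)    ()
shift-injective K -[1+ _ ] +[1+ _ ] ()

InX-split : ∀ K {K′} x → InX (K + K′) x → InX K x ⊎ Σ ℤ (λ y → x ≡ shift K y × InX K′ y)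
InX-split K {K′} x (1≤∣x∣ , ∣x∣≤K+K′) with ∣ x ∣ ≤? K
... | yes ∣x∣≤K = inj₁ (1≤∣x∣ , ∣x∣≤K)
... | no ∣x∣≰K  = inj₂ (unshifted x (ℕ.≰⇒> ∣x∣≰K) ∣x∣≤K+K′)
  where
  unshifted : ∀ x → K ℕ.< ∣ x ∣ → ∣ x ∣ ≤ K + K′ → Σ ℤ (λ y → x ≡ shift K y × InX K′ y)
  unshifted (+ 0)    ()
  unshifted +[1+ n ] (s≤s K≤n) 1+n≤K+K′ =
    +[1+ n ∸ K ] , cong +[1+_] (sym (ℕ.m∸n+n≡m K≤n)) , s≤s z≤n ,
    ℕ.+-cancelʳ-≤ K _ _ (subst₂ _≤_ (cong ℕ.suc (sym (ℕ.m∸n+n≡m K≤n))) (ℕ.+-comm K K′) 1+n≤K+K′)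
  unshifted -[1+ n ] (s≤s K≤n) 1+n≤K+K′ =
    -[1+ n ∸ K ] , cong -[1+_] (sym (ℕ.m∸n+n≡m K≤n)) , s≤s z≤n ,
    ℕ.+-cancelʳ-≤ K _ _ (subst₂ _≤_ (cong ℕ.suc (sym (ℕ.m∸n+n≡m K≤n))) (ℕ.+-comm K K′) 1+n≤K+K′)

-- Block-diagonal sums

transpose : Array m n → Array n m
transpose A j i = A i j

shiftArray : ℕ → Array m n → Array m n
shiftArray K A i j = shiftCell K (A i j)

blockDiagonal : Array m n → Array m′ n′ → Fin m ⊎ Fin m′ → Fin n ⊎ Fin n′ → Maybe ℤ
blockDiagonal A B (inj₁ i) (inj₁ j) = A i j
blockDiagonal A B (inj₂ i) (inj₂ j) = B i j
blockDiagonal A B _        _        = nothing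

_⊕_ : Array m n → Array m′ n′ → Array (m + m′) (n + n′)
_⊕_ {m} {n} A B k l = blockDiagonal A B (splitAt m k) (splitAt n l)

EntriesIn : ℕ → Array m n → Set
EntriesIn K A = ∀ i j x → A i j ≡ just x → InX K x

EachOnce : ℕ → Array m n → Set
EachOnce K A = ∀ x → InX K x → #occ A x ≡ 1

occurs? : (x : ℤ) → Decidable (_≡ just x)
occurs? x c = ≡-dec ℤ._≟_ c (just x)

row-shiftArray : ∀ K (A : Array m n) i → row (shiftArray K A) i ≡ map (shiftCell K) (row A i)
row-shiftArray K A i = map-∘ (allFin _)

cells-shiftArray : ∀ K (A : Array m n) → cells (shiftArray K A) ≡ map (shiftCell K) (cells A)
cells-shiftArray {m} K A = begin
  concat (map (row (shiftArray K A)) (allFin m))       ≡⟨ cong concat (map-cong (row-shiftArray K A) (allFin m)) ⟩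
  concat (map (map (shiftCell K) ∘ row A) (allFin m))  ≡⟨ cong concat (map-∘ (allFin m)) ⟩
  concat (map (map (shiftCell K)) (map (row A) (allFin m))) ≡⟨ concat-map (map (row A) (allFin m)) ⟩
  map (shiftCell K) (cells A)                          ∎

rows-magic-shiftArray : ∀ K {A : Array m n} → (∀ i → MagicLine r (row A i)) →
                        ∀ i → MagicLine r (row (shiftArray K A) i)
rows-magic-shiftArray {r = r} K {A} LA i = subst (MagicLine r) (sym (row-shiftArray K A i)) (magic-shift K (LA i))

module _ {P : Pred (Maybe ℤ) 0ℓ} (P? : Decidable P) where

  count-cells : (A : Array m n) → count P? (cells A) ≡ sum (map (count P? ∘ row A) (allFin m))
  count-cells {m} A = trans (count-concat P? (map (row A) (allFin m))) (cong sum (sym (map-∘ (allFin m))))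

  count-cells-none : (A : Array m n) → (∀ i j → ¬ P (A i j)) → count P? (cells A) ≡ 0
  count-cells-none A ¬P = count-none P? (concat⁺ (map⁺ (tabulate⁺ λ i → map⁺ (tabulate⁺ (¬P i)))))

module _ {A : Array m n} {B : Array m′ n′} where

  ⊕-cell : ∀ s t → (A ⊕ B) (join m m′ s) (join n n′ t) ≡ blockDiagonal A B s t
  ⊕-cell s t = cong₂ (blockDiagonal A B) (splitAt-join m m′ s) (splitAt-join n n′ t)

  row-⊕ˡ : ∀ i → row (A ⊕ B) (i ↑ˡ m′) ≡ row A i ++ blank n′
  row-⊕ˡ i = begin
    row (A ⊕ B) (i ↑ˡ m′)                          ≡⟨ map-allFin-+ n _ ⟩
    map (λ j → (A ⊕ B) (i ↑ˡ m′) (j ↑ˡ n′)) (allFin n) ++ map (λ j → (A ⊕ B) (i ↑ˡ m′) (n ↑ʳ j)) (allFin n′)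
      ≡⟨ cong₂ _++_ (map-cong (⊕-cell (inj₁ i) ∘ inj₁) (allFin n)) (map-cong (⊕-cell (inj₁ i) ∘ inj₂) (allFin n′)) ⟩
    row A i ++ map (λ _ → nothing) (allFin n′)      ≡⟨ cong (row A i ++_) (map-allFin-const n′ nothing) ⟩
    row A i ++ blank n′                            ∎

  row-⊕ʳ : ∀ i → row (A ⊕ B) (m ↑ʳ i) ≡ blank n ++ row B i
  row-⊕ʳ i = begin
    row (A ⊕ B) (m ↑ʳ i)                           ≡⟨ map-allFin-+ n _ ⟩
    map (λ j → (A ⊕ B) (m ↑ʳ i) (j ↑ˡ n′)) (allFin n) ++ map (λ j → (A ⊕ B) (m ↑ʳ i) (n ↑ʳ j)) (allFin n′)
      ≡⟨ cong₂ _++_ (map-cong (⊕-cell (inj₂ i) ∘ inj₁) (allFin n)) (map-cong (⊕-cell (inj₂ i) ∘ inj₂) (allFin n′)) ⟩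
    map (λ _ → nothing) (allFin n) ++ row B i       ≡⟨ cong (_++ row B i) (map-allFin-const n nothing) ⟩
    blank n ++ row B i                             ∎

  col-⊕ : ∀ l → col (A ⊕ B) l ≡ row (transpose A ⊕ transpose B) l
  col-⊕ l = map-cong (λ k → blockDiagonal-transpose (splitAt m k) (splitAt n l)) (allFin (m + m′))
    where
    blockDiagonal-transpose : ∀ s t → blockDiagonal A B s t ≡ blockDiagonal (transpose A) (transpose B) t s
    blockDiagonal-transpose (inj₁ i) (inj₁ j) = refl
    blockDiagonal-transpose (inj₁ i) (inj₂ j) = refl
    blockDiagonal-transpose (inj₂ i) (inj₁ j) = refl
    blockDiagonal-transpose (inj₂ i) (inj₂ j) = refl

  ⊕-just : ∀ k l {x} → (A ⊕ B) k l ≡ just x → ∃₂ (λ i j → A i j ≡ just x) ⊎ ∃₂ (λ i j → B i j ≡ just x)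
  ⊕-just k l = fromBlock (splitAt m k) (splitAt n l)
    where
    fromBlock : ∀ s t {x} → blockDiagonal A B s t ≡ just x → ∃₂ (λ i j → A i j ≡ just x) ⊎ ∃₂ (λ i j → B i j ≡ just x)
    fromBlock (inj₁ i) (inj₁ j) e = inj₁ (i , j , e)
    fromBlock (inj₂ i) (inj₂ j) e = inj₂ (i , j , e)

  ⊕-rows-magic : (∀ i → MagicLine r (row A i)) → (∀ i → MagicLine r (row B i)) →
                 ∀ k → MagicLine r (row (A ⊕ B) k)
  ⊕-rows-magic {r} LA LB k = subst (MagicLine r ∘ row (A ⊕ B)) (join-splitAt m m′ k) (byBlock (splitAt m k))
    where
    byBlock : ∀ s → MagicLine r (row (A ⊕ B) (join m m′ s))
    byBlock (inj₁ i) = subst₂ MagicLine (ℕ.+-identityʳ r) (sym (row-⊕ˡ i)) (magic-++ (LA i) (magic-blank n′))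
    byBlock (inj₂ i) = subst (MagicLine r) (sym (row-⊕ʳ i)) (magic-++ (magic-blank n) (LB i))

  count-cells-⊕ : ∀ {P : Pred (Maybe ℤ) 0ℓ} (P? : Decidable P) → ¬ P nothing →
                  count P? (cells (A ⊕ B)) ≡ count P? (cells A) + count P? (cells B)
  count-cells-⊕ P? ¬P∅ = begin
    count P? (cells (A ⊕ B))                                       ≡⟨ count-cells P? (A ⊕ B) ⟩
    sum (map (count P? ∘ row (A ⊕ B)) (allFin (m + m′)))             ≡⟨ cong sum (map-allFin-+ m _) ⟩
    sum (map (count P? ∘ row (A ⊕ B) ∘ (_↑ˡ m′)) (allFin m) ++ map (count P? ∘ row (A ⊕ B) ∘ (m ↑ʳ_)) (allFin m′))
      ≡⟨ sum-++ (map _ (allFin m)) _ ⟩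
    sum (map (count P? ∘ row (A ⊕ B) ∘ (_↑ˡ m′)) (allFin m)) + sum (map (count P? ∘ row (A ⊕ B) ∘ (m ↑ʳ_)) (allFin m′))
      ≡⟨ cong₂ _+_ (cong sum (map-cong upper (allFin m))) (cong sum (map-cong lower (allFin m′))) ⟩
    sum (map (count P? ∘ row A) (allFin m)) + sum (map (count P? ∘ row B) (allFin m′))
      ≡⟨ sym (cong₂ _+_ (count-cells P? A) (count-cells P? B)) ⟩
    count P? (cells A) + count P? (cells B)                       ∎
    where
    upper : ∀ i → count P? (row (A ⊕ B) (i ↑ˡ m′)) ≡ count P? (row A i)
    upper i = begin
      count P? (row (A ⊕ B) (i ↑ˡ m′))          ≡⟨ cong (count P?) (row-⊕ˡ i) ⟩
      count P? (row A i ++ blank n′)            ≡⟨ count-++ P? (row A i) (blank n′) ⟩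
      count P? (row A i) + count P? (blank n′)  ≡⟨ cong (_+_ (count P? (row A i))) (count-blank P? ¬P∅ n′) ⟩
      count P? (row A i) + 0                    ≡⟨ ℕ.+-identityʳ _ ⟩
      count P? (row A i)                        ∎
    lower : ∀ i → count P? (row (A ⊕ B) (m ↑ʳ i)) ≡ count P? (row B i)
    lower i = begin
      count P? (row (A ⊕ B) (m ↑ʳ i))           ≡⟨ cong (count P?) (row-⊕ʳ i) ⟩
      count P? (blank n ++ row B i)             ≡⟨ count-++ P? (blank n) (row B i) ⟩
      count P? (blank n) + count P? (row B i)   ≡⟨ cong (_+ count P? (row B i)) (count-blank P? ¬P∅ n) ⟩
      count P? (row B i)                        ∎

⊕-cols-magic : ∀ {A : Array m n} {B : Array m′ n′} → (∀ j → MagicLine s (col A j)) →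
               (∀ j → MagicLine s (col B j)) → ∀ l → MagicLine s (col (A ⊕ B) l)
⊕-cols-magic {s = s} {A = A} {B} LA LB l =
  subst (MagicLine s) (sym (col-⊕ {A = A} {B} l)) (⊕-rows-magic {A = transpose A} {B = transpose B} LA LB l)

ShiftableSMR : (m n r s : ℕ) → Array m n → Set
ShiftableSMR m n r s A = IsSMR m n r s A × IsShiftable A

rows-magic : ∀ {A : Array m n} → ShiftableSMR m n r s A → ∀ i → MagicLine r (row A i)
rows-magic (S , H) i = record
  { filled = IsSMR.rowCount S i ; sumZero = IsSMR.rowSum S i ; balanced = IsShiftable.rowBal H i }

cols-magic : ∀ {A : Array m n} → ShiftableSMR m n r s A → ∀ j → MagicLine s (col A j)
cols-magic (S , H) j = record
  { filled = IsSMR.colCount S j ; sumZero = IsSMR.colSum S j ; balanced = IsShiftable.colBal H j }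

shift-⊕-entriesIn : ∀ {A : Array m n} {B : Array m′ n′} → EntriesIn K A → EntriesIn K′ B →
                    EntriesIn (K + K′) (A ⊕ shiftArray K B)
shift-⊕-entriesIn {K = K} {K′} {A} {B} inA inB k l x e with ⊕-just {A = A} k l e
... | inj₁ (i , j , Aij≡x) = InX-weaken K′ x (inA i j x Aij≡x)
... | inj₂ (i , j , Bij⁺≡x) with B i j in Bij≡y
...   | just y with refl ← Bij⁺≡x = InX-shift K y (inB i j y Bij≡y)

shift-⊕-eachOnce : ∀ {A : Array m n} {B : Array m′ n′} → EntriesIn K A → EachOnce K A → EachOnce K′ B →
                   EachOnce (K + K′) (A ⊕ shiftArray K B)
shift-⊕-eachOnce {K = K} {A = A} {B} inA onceA onceB x x∈X =
  trans (count-cells-⊕ {A = A} (occurs? x) (λ ())) (bySource (InX-split K x x∈X))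
  where
  bySource : InX K x ⊎ Σ ℤ (λ y → x ≡ shift K y × InX _ y) →
             #occ A x + count (occurs? x) (cells (shiftArray K B)) ≡ 1
  bySource (inj₁ x∈XK) = begin
    #occ A x + count (occurs? x) (cells (shiftArray K B))   ≡⟨ cong₂ _+_ (onceA x x∈XK) (cong (count (occurs? x)) (cells-shiftArray K B)) ⟩
    1 + count (occurs? x) (map (shiftCell K) (cells B))      ≡⟨ cong (_+_ 1) (count-none (occurs? x) (map⁺ (universal missed (cells B)))) ⟩
    1                                                       ∎
    where
    missed : ∀ c → shiftCell K c ≢ just x
    missed (just y) e = shift-∉ K y x x∈XK (just-injective e)
  bySource (inj₂ (y , refl , y∈XK′)) = begin
    #occ A (shift K y) + count (occurs? (shift K y)) (cells (shiftArray K B))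
      ≡⟨ cong₂ _+_ (count-cells-none (occurs? (shift K y)) A (λ i j e → shift-∉ K y (shift K y) (inA i j _ e) refl))
                   (cong (count (occurs? (shift K y))) (cells-shiftArray K B)) ⟩
    count (occurs? (shift K y)) (map (shiftCell K) (cells B))
      ≡⟨ count-map (occurs? (shift K y)) (occurs? y) (shiftCell K) unshift (λ { _ refl → refl }) (cells B) ⟩
    #occ B y                                                ≡⟨ onceB y y∈XK′ ⟩
    1                                                       ∎
    where
    unshift : ∀ c → shiftCell K c ≡ just (shift K y) → c ≡ just y
    unshift (just z) e = cong just (shift-injective K z y (just-injective e))

half-+ : ∀ m m′ {r} → 2 ∣ r → (m + m′) * r / 2 ≡ m * r / 2 + m′ * r / 2
half-+ m m′ {r} 2∣r = trans (cong (_/ 2) (ℕ.*-distribʳ-+ r m m′)) (+-distrib-/-∣ˡ (m′ * r) (∣n⇒∣m*n m 2∣r))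

shiftableSMR-⊕ : ∀ {A : Array m n} {B : Array m′ n′} → 2 ∣ r →
                 ShiftableSMR m n r s A → ShiftableSMR m′ n′ r s B →
                 ShiftableSMR (m + m′) (n + n′) r s (A ⊕ shiftArray (m * r / 2) B)
shiftableSMR-⊕ {m} {n} {m′} {n′} {r} {s} {A} {B} 2∣r SA SB =
  record
    { rowCount   = filled ∘ rows
    ; colCount   = filled ∘ cols
    ; entriesInX = subst (λ K → EntriesIn K C) (sym halves)
                     (shift-⊕-entriesIn {A = A} (IsSMR.entriesInX (proj₁ SA)) (IsSMR.entriesInX (proj₁ SB)))
    ; eachOnce   = subst (λ K → EachOnce K C) (sym halves)
                     (shift-⊕-eachOnce {A = A} (IsSMR.entriesInX (proj₁ SA)) (IsSMR.eachOnce (proj₁ SA)) (IsSMR.eachOnce (proj₁ SB)))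
    ; rowSum     = sumZero ∘ rows
    ; colSum     = sumZero ∘ cols
    }
  , record { rowBal = balanced ∘ rows ; colBal = balanced ∘ cols }
  where
  offset : ℕ
  offset = m * r / 2
  C : Array (m + m′) (n + n′)
  C = A ⊕ shiftArray offset B
  halves : (m + m′) * r / 2 ≡ offset + m′ * r / 2
  halves = half-+ m m′ 2∣r
  rows : ∀ k → MagicLine r (row C k)
  rows = ⊕-rows-magic (rows-magic SA) (rows-magic-shiftArray offset (rows-magic SB))
  cols : ∀ l → MagicLine s (col C l)
  cols = ⊕-cols-magic {A = A} (cols-magic SA) (rows-magic-shiftArray offset {transpose B} (cols-magic SB))

-- Checking a concrete array

InX? : ∀ K x → Dec (InX K x)
InX? K x = (1 ≤? ∣ x ∣) ×-dec (∣ x ∣ ≤? K)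

entriesIn? : ∀ K (A : Array m n) → Dec (EntriesIn K A)
entriesIn? K A = all? λ i → all? λ j → cellIn? (A i j)
  where
  cellIn? : ∀ c → Dec (∀ x → c ≡ just x → InX K x)
  cellIn? nothing  = yes λ _ ()
  cellIn? (just x) = map′ (λ { x∈X _ refl → x∈X }) (λ h → h x refl) (InX? K x)

eachOnce? : ∀ K (A : Array m n) → Dec (EachOnce K A)
eachOnce? K A = map′ fromFin toFin (all? λ k → (#occ A +[1+ toℕ k ] ≟ 1) ×-dec (#occ A -[1+ toℕ k ] ≟ 1))
  where
  OnceFin : Set
  OnceFin = ∀ (k : Fin K) → #occ A +[1+ toℕ k ] ≡ 1 × #occ A -[1+ toℕ k ] ≡ 1
  fromFin : OnceFin → EachOnce K A
  fromFin h (+ 0)    (() , _)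
  fromFin h +[1+ n ] (_ , 1+n≤K) = subst (λ n → #occ A +[1+ n ] ≡ 1) (toℕ-fromℕ< 1+n≤K) (proj₁ (h (fromℕ< 1+n≤K)))
  fromFin h -[1+ n ] (_ , 1+n≤K) = subst (λ n → #occ A -[1+ n ] ≡ 1) (toℕ-fromℕ< 1+n≤K) (proj₂ (h (fromℕ< 1+n≤K)))
  toFin : EachOnce K A → OnceFin
  toFin h k = h +[1+ toℕ k ] (s≤s z≤n , toℕ<n k) , h -[1+ toℕ k ] (s≤s z≤n , toℕ<n k)

isSMR? : ∀ {m n} r s (A : Array m n) → Dec (IsSMR m n r s A)
isSMR? {m} {n} r s A = map′ fromChecks toChecks
  (all? (λ i → #filled (row A i) ≟ r) ×-dec all? (λ j → #filled (col A j) ≟ s) ×-dec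
   entriesIn? (m * r / 2) A ×-dec eachOnce? (m * r / 2) A ×-dec
   all? (λ i → zsum (row A i) ℤ.≟ 0ℤ) ×-dec all? (λ j → zsum (col A j) ℤ.≟ 0ℤ))
  where
  Checks : Set
  Checks = (∀ i → #filled (row A i) ≡ r) × (∀ j → #filled (col A j) ≡ s) × EntriesIn (m * r / 2) A × EachOnce (m * r / 2) A ×
           (∀ i → zsum (row A i) ≡ 0ℤ) × (∀ j → zsum (col A j) ≡ 0ℤ)
  fromChecks : Checks → IsSMR m n r s A
  fromChecks (rc , cc , ex , eo , rs , cs) = record
    { rowCount = rc ; colCount = cc ; entriesInX = ex ; eachOnce = eo ; rowSum = rs ; colSum = cs }
  toChecks : IsSMR m n r s A → Checks
  toChecks S = rowCount , colCount , entriesInX , eachOnce , rowSum , colSum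
    where open IsSMR S

isShiftable? : (A : Array m n) → Dec (IsShiftable A)
isShiftable? A = map′ (λ (rb , cb) → record { rowBal = rb ; colBal = cb })
                      (λ H → IsShiftable.rowBal H , IsShiftable.colBal H)
                      (all? (λ i → #pos (row A i) ≟ #neg (row A i)) ×-dec all? (λ j → #pos (col A j) ≟ #neg (col A j)))

shiftableSMR? : ∀ r s (A : Array m n) → Dec (ShiftableSMR m n r s A)
shiftableSMR? r s A = isSMR? r s A ×-dec isShiftable? A

pairedColumns : ∀ m {n} → Vec ℕ n → Vec ℕ n → Array m n
pairedColumns m pos neg i j =
  if lookup pos j ≡ᵇ toℕ i then just +[1+ toℕ j ] else
  if lookup neg j ≡ᵇ toℕ i then just -[1+ toℕ j ] else nothing

HasShiftableSMR : ℕ → Set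
HasShiftableSMR m = Σ (Array m (3 * m)) (ShiftableSMR m (3 * m) 6 2)

smr₄ : HasShiftableSMR 4
smr₄ = A , from-yes (shiftableSMR? 6 2 A)
  where
  A : Array 4 12
  A = pairedColumns 4 (3 ∷ᵥ 1 ∷ᵥ 0 ∷ᵥ 0 ∷ᵥ 2 ∷ᵥ 3 ∷ᵥ 0 ∷ᵥ 2 ∷ᵥ 1 ∷ᵥ 1 ∷ᵥ 3 ∷ᵥ 2 ∷ᵥ []ᵥ)
                      (0 ∷ᵥ 3 ∷ᵥ 1 ∷ᵥ 3 ∷ᵥ 0 ∷ᵥ 2 ∷ᵥ 1 ∷ᵥ 0 ∷ᵥ 2 ∷ᵥ 2 ∷ᵥ 1 ∷ᵥ 3 ∷ᵥ []ᵥ)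

smr₆ : HasShiftableSMR 6
smr₆ = A , from-yes (shiftableSMR? 6 2 A)
  where
  A : Array 6 18
  A = pairedColumns 6 (5 ∷ᵥ 5 ∷ᵥ 4 ∷ᵥ 1 ∷ᵥ 0 ∷ᵥ 2 ∷ᵥ 2 ∷ᵥ 0 ∷ᵥ 4 ∷ᵥ 3 ∷ᵥ 3 ∷ᵥ 1 ∷ᵥ 3 ∷ᵥ 2 ∷ᵥ 4 ∷ᵥ 0 ∷ᵥ 5 ∷ᵥ 1 ∷ᵥ []ᵥ)
                      (4 ∷ᵥ 2 ∷ᵥ 5 ∷ᵥ 3 ∷ᵥ 1 ∷ᵥ 5 ∷ᵥ 0 ∷ᵥ 2 ∷ᵥ 0 ∷ᵥ 4 ∷ᵥ 5 ∷ᵥ 3 ∷ᵥ 0 ∷ᵥ 1 ∷ᵥ 1 ∷ᵥ 4 ∷ᵥ 2 ∷ᵥ 3 ∷ᵥ []ᵥ)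

hasShiftableSMR-+ : HasShiftableSMR m → HasShiftableSMR m′ → HasShiftableSMR (m + m′)
hasShiftableSMR-+ {m} {m′} (A , SA) (B , SB) =
  subst (λ n → Σ (Array (m + m′) n) (ShiftableSMR (m + m′) n 6 2)) (sym (ℕ.*-distribˡ-+ 3 m m′))
    (A ⊕ shiftArray (m * 6 / 2) B , shiftableSMR-⊕ (divides 3 refl) SA SB)

hasShiftableSMR-4b+6 : ∀ b → HasShiftableSMR (4 * ℕ.suc b + 2)
hasShiftableSMR-4b+6 ℕ.zero    = smr₆
hasShiftableSMR-4b+6 (ℕ.suc b) =
  subst HasShiftableSMR 4+[4b+6]≡4[b+2]+2 (hasShiftableSMR-+ smr₄ (hasShiftableSMR-4b+6 b))
  where
  4+[4b+6]≡4[b+2]+2 : 4 + (4 * ℕ.suc b + 2) ≡ 4 * ℕ.suc (ℕ.suc b) + 2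
  4+[4b+6]≡4[b+2]+2 = sym (trans (cong (_+ 2) (ℕ.*-suc 4 (ℕ.suc b))) (ℕ.+-assoc 4 (4 * ℕ.suc b) 2))

lemma17 : (b : ℕ) → 1 ≤ b →
    Σ (Array (4 * b + 2) (3 * (4 * b + 2))) λ A →
      IsSMR (4 * b + 2) (3 * (4 * b + 2)) 6 2 A × IsShiftable A
lemma17 (ℕ.suc b) _ = hasShiftableSMR-4b+6 b
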